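{- Let $\Phi$ be an irreducible crystallographic root system with positive roots $\Phi^+$ and root poset order $\le$. If $\alpha,\beta,\gamma\in\Phi^+$, $\beta+\gamma\in\Phi^+$ and $\alpha\le\beta+\gamma$, then $\alpha\le\beta$, or $\alpha\le\gamma$, or $\alpha=\beta'+\gamma'$ for some $\beta',\gamma'\in\Phi^+$ with $\beta'\le\beta$ and $\gamma'\le\gamma$.
   Context: The root poset order on $\Phi^+$: $\alpha\le\beta$ iff $\beta-\alpha$ is a linear combination of simple roots with nonnegative integer coefficients.
   Formalization: The root system Φ lies in ℚ^n, and its inner product is a positive definite symmetric bilinear form with rational values. -}

module Defs where

open import Data.Nat using (ℕ; zero; suc)
open import Data.Integer using (ℤ; +_)
open import Data.Fin using (Fin; zero; suc)
open import Data.Rational using (ℚ; 0ℚ; _+_; _-_; _*_; _/_; _<_)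
open import Data.Product using (Σ; ∃; _×_; _,_)
open import Data.Sum using (_⊎_)
open import Data.Bool using (Bool; true; false)
open import Relation.Binary.PropositionalEquality using (_≡_)
open import Relation.Nullary using (¬_)
open import Function using (_∘_)

Vecℚ : ℕ → Set
Vecℚ n = Fin n → ℚ

_≐_ : ∀ {n} → Vecℚ n → Vecℚ n → Set
u ≐ v = ∀ i → u i ≡ v i
infix 4 _≐_

_+ᵥ_ : ∀ {n} → Vecℚ n → Vecℚ n → Vecℚ n
(u +ᵥ v) i = u i + v i

_-ᵥ_ : ∀ {n} → Vecℚ n → Vecℚ n → Vecℚ n
(u -ᵥ v) i = u i - v i

_·ᵥ_ : ∀ {n} → ℚ → Vecℚ n → Vecℚ n
(c ·ᵥ v) i = c * v i

0ᵥ : ∀ {n} → Vecℚ n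
0ᵥ _ = 0ℚ

ℤtoℚ : ℤ → ℚ
ℤtoℚ k = k / 1

ℕtoℚ : ℕ → ℚ
ℕtoℚ k = (+ k) / 1

Σᶠ : ∀ {m} → (Fin m → ℚ) → ℚ
Σᶠ {zero} f = 0ℚ
Σᶠ {suc m} f = f zero + Σᶠ (f ∘ suc)

lincomb : ∀ {r n} → (Fin r → ℚ) → (Fin r → Vecℚ n) → Vecℚ n
lincomb c v i = Σᶠ (λ k → c k * v k i)

record InnerProduct (n : ℕ) : Set where
  field
    gram : Fin n → Fin n → ℚ
  ⟪_,_⟫ : Vecℚ n → Vecℚ n → ℚ
  ⟪ u , v ⟫ = Σᶠ (λ i → Σᶠ (λ j → u i * gram i j * v j))
  field
    symmetric : ∀ i j → gram i j ≡ gram j i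
    posdef    : ∀ v → ¬ (v ≐ 0ᵥ) → 0ℚ < ⟪ v , v ⟫

-- membership in a finite family of vectors (the set Φ is the image of the enumeration)
_∈ᶠ_ : ∀ {n N} → Vecℚ n → (Fin N → Vecℚ n) → Set
v ∈ᶠ Φ = ∃ λ i → Φ i ≐ v
infix 4 _∈ᶠ_

module _ {n : ℕ} (E : InnerProduct n) where
  open InnerProduct E

  -- Φ is a reduced crystallographic root system (in the subspace it spans):
  --  * 0 ∉ Φ
  --  * for α, β ∈ Φ the Cartan integer ⟨β,α^∨⟩ = 2⟪β,α⟫/⟪α,α⟫ is an integer k,
  --    and the reflection s_α(β) = β - k α lies in Φ
  --  * the only multiples of α in Φ are ±α.
  record IsRootSystem {N : ℕ} (Φ : Fin N → Vecℚ n) : Set where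
    field
      nonzero : ∀ i → ¬ (Φ i ≐ 0ᵥ)
      crystallographic : ∀ i j → Σ ℤ λ k →
        (ℤtoℚ (+ 2) * ⟪ Φ j , Φ i ⟫ ≡ ℤtoℚ k * ⟪ Φ i , Φ i ⟫)
        × ((Φ j -ᵥ (ℤtoℚ k ·ᵥ Φ i)) ∈ᶠ Φ)
      reduced : ∀ i (c : ℚ) → (c ·ᵥ Φ i) ∈ᶠ Φ →
        (c ≡ ℤtoℚ (+ 1)) ⊎ (c ≡ ℤtoℚ (Data.Integer.-[1+ 0 ]))

  -- Irreducible: Φ nonempty and not a union of two nonempty mutually orthogonal subsets.
  Irreducible : ∀ {N} → (Fin N → Vecℚ n) → Set
  Irreducible {N} Φ =
    Fin N ×
    (∀ (P : Fin N → Bool) →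
       (∀ i j → P i ≡ true → P j ≡ false → ⟪ Φ i , Φ j ⟫ ≡ 0ℚ) →
       (∀ i → P i ≡ true) ⊎ (∀ i → P i ≡ false))

record IsBase {n N r : ℕ} (Φ : Fin N → Vecℚ n) (Δ : Fin r → Vecℚ n) : Set where
  field
    inΦ : ∀ k → Δ k ∈ᶠ Φ
    independent : ∀ (c : Fin r → ℚ) → lincomb c Δ ≐ 0ᵥ → ∀ k → c k ≡ 0ℚ
    spans : ∀ i → (∃ λ (c : Fin r → ℕ) → Φ i ≐ lincomb (ℕtoℚ ∘ c) Δ)
                ⊎ (∃ λ (c : Fin r → ℕ) → Φ i ≐ lincomb (λ k → ℤtoℚ (Data.Integer.- (+ c k))) Δ)

module _ {n N r : ℕ} (Φ : Fin N → Vecℚ n) (Δ : Fin r → Vecℚ n) where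

  NonnegComb : Vecℚ n → Set
  NonnegComb v = ∃ λ (c : Fin r → ℕ) → v ≐ lincomb (ℕtoℚ ∘ c) Δ

  Positive : Vecℚ n → Set
  Positive v = v ∈ᶠ Φ × NonnegComb v

  _≼_ : Vecℚ n → Vecℚ n → Set
  α ≼ β = NonnegComb (β -ᵥ α)

-- Induction on the height of β + γ − α.  If α < β + γ, some simple root δ can be removed from
-- β + γ while staying a positive root above α (the simple root is found by expanding
-- ⟪β + γ − α, β + γ − α⟫ > 0 in simple roots).  As β + γ − δ is a root, a comparison of inner
-- products shows that δ can be removed from β or from γ, leaving a positive root or 0, and the
-- induction hypothesis applies to the smaller pair.  Both steps rest on the crystallographic fact
-- that ⟪u, v⟫ > 0 makes u − v a root or zero.

module Submission where

open import Defs
open import Data.Nat using (ℕ)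
open import Data.Fin using (Fin)
open import Data.Product using (∃; _×_)
open import Data.Sum using (_⊎_)

open import Algebra.Bundles using (CommutativeRing)
import Algebra.Construct.Pointwise as Pointwise
import Algebra.Properties.Group as GroupProperties
import Algebra.Properties.CommutativeMonoid.Sum as CommutativeMonoidSum
import Algebra.Properties.Semiring.Sum as SemiringSum
open import Data.Empty using (⊥-elim)
open import Data.Fin using (zero; suc)
import Data.Fin.Properties as Finₚ
open import Data.Integer as ℤ using (-[1+_])
import Data.Integer.Properties as ℤₚ
open import Data.Nat as ℕ using (zero; suc; z≤n; s≤s)
import Data.Nat.Coprimality as Coprimality
import Data.Nat.Properties as ℕₚ
open import Data.Product using (_,_; proj₁)
open import Data.Rational as ℚ using (ℚ; mkℚ; 0ℚ; 1ℚ; _+_; _-_; _*_; -_; _<_; _≤_; 1/_)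
import Data.Rational.Properties as ℚₚ
open import Data.Rational.Solver using (module +-*-Solver)
open import Data.Sum as Sum using (inj₁; inj₂)
open import Function using (_∘_; case_of_)
open import Relation.Binary.PropositionalEquality
open import Relation.Binary.Structures using (IsEquivalence)
open import Relation.Nullary using (¬_; yes; no)

open +-*-Solver using (solve; con; _:+_; _:-_; _:*_; :-_; _:=_)

ℕtoℚ≡mkℚ : ∀ k → ℕtoℚ k ≡ mkℚ (ℤ.+ k) 0 (Coprimality.sym (Coprimality.1-coprimeTo k))
ℕtoℚ≡mkℚ k = ℚₚ.↥p/↧p≡p _

-- The last step is definitional: on normalised fractions, p + q unfolds to (↥p ↧q + ↥q ↧p) / (↧p ↧q).
ℕtoℚ-+ : ∀ a b → ℕtoℚ (a ℕ.+ b) ≡ ℕtoℚ a + ℕtoℚ b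
ℕtoℚ-+ a b = begin
  ℕtoℚ (a ℕ.+ b)
    ≡⟨ cong (ℚ._/ 1) (ℤₚ.pos-+ a b) ⟩
  (ℤ.+ a ℤ.+ ℤ.+ b) ℚ./ 1
    ≡⟨ cong₂ (λ x y → (x ℤ.+ y) ℚ./ 1) (ℤₚ.*-identityʳ (ℤ.+ a)) (ℤₚ.*-identityʳ (ℤ.+ b)) ⟨
  (ℤ.+ a ℤ.* ℤ.+ 1 ℤ.+ ℤ.+ b ℤ.* ℤ.+ 1) ℚ./ 1
    ≡⟨ cong₂ _+_ (ℕtoℚ≡mkℚ a) (ℕtoℚ≡mkℚ b) ⟨
  ℕtoℚ a + ℕtoℚ b ∎
  where open ≡-Reasoning

ℕtoℚ-injective : ∀ {a b} → ℕtoℚ a ≡ ℕtoℚ b → a ≡ b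
ℕtoℚ-injective {a} {b} eq = cong (ℤ.∣_∣ ∘ ℚ.↥_) (trans (sym (ℕtoℚ≡mkℚ a)) (trans eq (ℕtoℚ≡mkℚ b)))

ℕtoℚ-nonNeg : ∀ k → 0ℚ ≤ ℕtoℚ k
ℕtoℚ-nonNeg k = subst (0ℚ ≤_) (sym (ℕtoℚ≡mkℚ k)) (ℚₚ.nonNegative⁻¹ _)

ℤtoℚ-neg : ∀ k → ℤtoℚ (ℤ.- (ℤ.+ k)) ≡ - ℕtoℚ k
ℤtoℚ-neg zero    = refl
ℤtoℚ-neg (suc k) = refl

<⇒≱ : ∀ {p q} → p < q → ¬ q ≤ p
<⇒≱ p<q q≤p = ℚₚ.<-irrefl refl (ℚₚ.<-≤-trans p<q q≤p)

+-nonNeg : ∀ {p q} → 0ℚ ≤ p → 0ℚ ≤ q → 0ℚ ≤ p + q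
+-nonNeg = ℚₚ.+-mono-≤

*-nonNeg : ∀ {p q} → 0ℚ ≤ p → 0ℚ ≤ q → 0ℚ ≤ p * q
*-nonNeg {p} {q} 0≤p 0≤q =
  ℚₚ.nonNegative⁻¹ (p * q) {{ℚₚ.nonNeg*nonNeg⇒nonNeg p {{ℚ.nonNegative 0≤p}} q {{ℚ.nonNegative 0≤q}}}}

*-pos : ∀ {p q} → 0ℚ < p → 0ℚ < q → 0ℚ < p * q
*-pos {p} {q} 0<p 0<q = ℚₚ.positive⁻¹ (p * q) {{ℚₚ.pos*pos⇒pos p {{ℚ.positive 0<p}} q {{ℚ.positive 0<q}}}}

neg-nonPos : ∀ {p} → 0ℚ ≤ p → - p ≤ 0ℚ
neg-nonPos = ℚₚ.neg-antimono-≤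

neg-nonNeg : ∀ {p} → p ≤ 0ℚ → 0ℚ ≤ - p
neg-nonNeg = ℚₚ.neg-antimono-≤

*-cancelʳ-≡-pos : ∀ {p q r} → 0ℚ < r → p * r ≡ q * r → p ≡ q
*-cancelʳ-≡-pos {r = r} 0<r pr≡qr = ℚₚ.≤-antisym (cancel (ℚₚ.≤-reflexive pr≡qr)) (cancel (ℚₚ.≤-reflexive (sym pr≡qr)))
  where
  cancel : ∀ {p q} → p * r ≤ q * r → p ≤ q
  cancel = ℚₚ.*-cancelʳ-≤-pos r {{ℚ.positive 0<r}}

ℕtoℚ*-pos⇒ : ∀ a y → 0ℚ < ℕtoℚ a * y → 1 ℕ.≤ a × 0ℚ < y
ℕtoℚ*-pos⇒ zero    y 0<0y = ⊥-elim (ℚₚ.<⇒≢ 0<0y (sym (ℚₚ.*-zeroˡ y)))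
ℕtoℚ*-pos⇒ (suc a) y 0<ay with 0ℚ ℚₚ.<? y
... | yes 0<y = s≤s z≤n , 0<y
... | no  0≮y = ⊥-elim (<⇒≱ 0<ay ay≤0)
  where
  ay≤0 : ℕtoℚ (suc a) * y ≤ 0ℚ
  ay≤0 = subst (ℕtoℚ (suc a) * y ≤_) (ℚₚ.*-zeroʳ (ℕtoℚ (suc a)))
               (ℚₚ.*-monoˡ-≤-nonNeg (ℕtoℚ (suc a)) {{ℚ.nonNegative (ℕtoℚ-nonNeg (suc a))}} (ℚₚ.≮⇒≥ 0≮y))

cartanInteger-pos : ∀ {P R} k → 0ℚ < P → 0ℚ < R → ℤtoℚ (ℤ.+ 2) * R ≡ ℤtoℚ k * P → ∃ λ m → k ≡ ℤ.+ suc m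
cartanInteger-pos {P} (ℤ.+ zero) 0<P 0<R 2R≡0P =
  ⊥-elim (ℚₚ.<⇒≢ (*-pos (ℚₚ.positive⁻¹ (ℕtoℚ 2)) 0<R) (sym (trans 2R≡0P (ℚₚ.*-zeroˡ P))))
cartanInteger-pos (ℤ.+ suc m) 0<P 0<R _ = m , refl
cartanInteger-pos {P} -[1+ m ] 0<P 0<R 2R≡kP =
  ⊥-elim (<⇒≱ (*-pos (ℚₚ.positive⁻¹ (ℕtoℚ 2)) 0<R) (subst (_≤ 0ℚ) (sym 2R≡kP) kP≤0))
  where
  kP≤0 : ℤtoℚ -[1+ m ] * P ≤ 0ℚ
  kP≤0 = subst (_≤ 0ℚ) (ℚₚ.neg-distribˡ-* (ℕtoℚ (suc m)) P)
               (neg-nonPos (*-nonNeg (ℕtoℚ-nonNeg (suc m)) (ℚₚ.<⇒≤ 0<P)))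

reverse-cauchySchwarz : ∀ {P Q R a a′} → 0ℚ ≤ P → 0ℚ ≤ Q → 0ℚ ≤ a → 0ℚ ≤ a′ →
                        ℕtoℚ 2 * R ≡ (ℕtoℚ 2 + a) * P → ℕtoℚ 2 * R ≡ (ℕtoℚ 2 + a′) * Q →
                        0ℚ ≤ R * R - P * Q
reverse-cauchySchwarz {P} {Q} {R} {a} {a′} 0≤P 0≤Q 0≤a 0≤a′ 2R≡[2+a]P 2R≡[2+a′]Q =
  ℚₚ.*-cancelˡ-≤-pos (ℕtoℚ 2 * ℕtoℚ 2) (subst (0ℚ ≤_) (sym 4[R²-PQ]≡) 0≤rhs)
  where
  open ≡-Reasoning
  t = ℕtoℚ 2
  4[R²-PQ]≡ : t * t * (R * R - P * Q) ≡ (t * a + t * a′ + a * a′) * (P * Q)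
  4[R²-PQ]≡ = begin
    t * t * (R * R - P * Q)
      ≡⟨ solve 4 (λ t R P Q → t :* t :* (R :* R :- P :* Q) := (t :* R) :* (t :* R) :- t :* t :* (P :* Q)) refl t R P Q ⟩
    (t * R) * (t * R) - t * t * (P * Q)
      ≡⟨ cong₂ (λ x y → x * y - t * t * (P * Q)) 2R≡[2+a]P 2R≡[2+a′]Q ⟩
    ((t + a) * P) * ((t + a′) * Q) - t * t * (P * Q)
      ≡⟨ solve 5 (λ t a a′ P Q → ((t :+ a) :* P) :* ((t :+ a′) :* Q) :- t :* t :* (P :* Q)
                                 := (t :* a :+ t :* a′ :+ a :* a′) :* (P :* Q)) refl t a a′ P Q ⟩
    (t * a + t * a′ + a * a′) * (P * Q) ∎
  0≤rhs : 0ℚ ≤ (t * a + t * a′ + a * a′) * (P * Q)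
  0≤rhs = *-nonNeg (+-nonNeg (+-nonNeg (*-nonNeg (ℕtoℚ-nonNeg 2) 0≤a) (*-nonNeg (ℕtoℚ-nonNeg 2) 0≤a′)) (*-nonNeg 0≤a 0≤a′))
                   (*-nonNeg 0≤P 0≤Q)

module ℚΣ = SemiringSum (CommutativeRing.semiring ℚₚ.+-*-commutativeRing)

Σᶠ≡sum : ∀ {m} (f : Fin m → ℚ) → Σᶠ f ≡ ℚΣ.sum f
Σᶠ≡sum {zero}  f = refl
Σᶠ≡sum {suc m} f = cong (f zero +_) (Σᶠ≡sum (f ∘ suc))

Σᶠ-cong : ∀ {m} {f g : Fin m → ℚ} → (∀ i → f i ≡ g i) → Σᶠ f ≡ Σᶠ g
Σᶠ-cong {m} {f} {g} f≗g = trans (Σᶠ≡sum f) (trans (ℚΣ.sum-cong-≗ f≗g) (sym (Σᶠ≡sum g)))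

Σᶠ-zero : ∀ m → Σᶠ {m} (λ _ → 0ℚ) ≡ 0ℚ
Σᶠ-zero m = trans (Σᶠ≡sum {m} (λ _ → 0ℚ)) (ℚΣ.sum-replicate-zero m)

Σᶠ-distrib-+ : ∀ {m} (f g : Fin m → ℚ) → Σᶠ (λ i → f i + g i) ≡ Σᶠ f + Σᶠ g
Σᶠ-distrib-+ f g = begin
  Σᶠ (λ i → f i + g i)   ≡⟨ Σᶠ≡sum (λ i → f i + g i) ⟩
  ℚΣ.sum (λ i → f i + g i) ≡⟨ ℚΣ.∑-distrib-+ f g ⟩
  ℚΣ.sum f + ℚΣ.sum g    ≡⟨ cong₂ _+_ (Σᶠ≡sum f) (Σᶠ≡sum g) ⟨
  Σᶠ f + Σᶠ g            ∎
  where open ≡-Reasoning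

Σᶠ-distrib-* : ∀ {m} (c : ℚ) (f : Fin m → ℚ) → Σᶠ (λ i → c * f i) ≡ c * Σᶠ f
Σᶠ-distrib-* c f = begin
  Σᶠ (λ i → c * f i)     ≡⟨ Σᶠ≡sum (λ i → c * f i) ⟩
  ℚΣ.sum (λ i → c * f i) ≡⟨ ℚΣ.*-distribˡ-sum c f ⟨
  c * ℚΣ.sum f           ≡⟨ cong (c *_) (Σᶠ≡sum f) ⟨
  c * Σᶠ f               ∎
  where open ≡-Reasoning

Σᶠ-distrib-neg : ∀ {m} (f : Fin m → ℚ) → Σᶠ (λ i → - f i) ≡ - Σᶠ f
Σᶠ-distrib-neg {zero}  f = refl
Σᶠ-distrib-neg {suc m} f =
  trans (cong (- f zero +_) (Σᶠ-distrib-neg (f ∘ suc))) (sym (ℚₚ.neg-distrib-+ (f zero) (Σᶠ (f ∘ suc))))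

Σᶠ-comm : ∀ {m k} (f : Fin m → Fin k → ℚ) → Σᶠ (λ i → Σᶠ (f i)) ≡ Σᶠ (λ j → Σᶠ (λ i → f i j))
Σᶠ-comm f = begin
  Σᶠ (λ i → Σᶠ (f i))                  ≡⟨ Σᶠ≡sum (λ i → Σᶠ (f i)) ⟩
  ℚΣ.sum (λ i → Σᶠ (f i))               ≡⟨ ℚΣ.sum-cong-≗ (λ i → Σᶠ≡sum (f i)) ⟩
  ℚΣ.sum (λ i → ℚΣ.sum (f i))           ≡⟨ ℚΣ.∑-comm f ⟩
  ℚΣ.sum (λ j → ℚΣ.sum (λ i → f i j))   ≡⟨ ℚΣ.sum-cong-≗ (λ j → Σᶠ≡sum (λ i → f i j)) ⟨
  ℚΣ.sum (λ j → Σᶠ (λ i → f i j))       ≡⟨ Σᶠ≡sum (λ j → Σᶠ (λ i → f i j)) ⟨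
  Σᶠ (λ j → Σᶠ (λ i → f i j))           ∎
  where open ≡-Reasoning

Σᶠ-pos⇒∃pos : ∀ {m} (f : Fin m → ℚ) → 0ℚ < Σᶠ f → ∃ λ i → 0ℚ < f i
Σᶠ-pos⇒∃pos {zero}  f 0<0 = ⊥-elim (ℚₚ.<-irrefl refl 0<0)
Σᶠ-pos⇒∃pos {suc m} f 0<Σ with f zero ℚₚ.≤? 0ℚ
... | no  f₀≰0 = zero , ℚₚ.≰⇒> f₀≰0
... | yes f₀≤0 with Σᶠ-pos⇒∃pos (f ∘ suc) (ℚₚ.<-≤-trans 0<Σ Σ≤tail)
  where
  Σ≤tail : Σᶠ f ≤ Σᶠ (f ∘ suc)
  Σ≤tail = subst (Σᶠ f ≤_) (ℚₚ.+-identityˡ _) (ℚₚ.+-monoˡ-≤ (Σᶠ (f ∘ suc)) f₀≤0)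
...   | i , 0<fᵢ = suc i , 0<fᵢ

-ᵥ_ : ∀ {n} → Vecℚ n → Vecℚ n
(-ᵥ v) i = - v i

module ≐ {n} = IsEquivalence (Pointwise.isEquivalence (Fin n) (isEquivalence {A = ℚ}))

lincomb-cong : ∀ {n r} {a b : Fin r → ℚ} (w : Fin r → Vecℚ n) → (∀ k → a k ≡ b k) → lincomb a w ≐ lincomb b w
lincomb-cong w a≗b t = Σᶠ-cong (λ k → cong (_* w k t) (a≗b k))

lincomb-distrib-+ : ∀ {n r} (a b : Fin r → ℚ) (w : Fin r → Vecℚ n) →
                    lincomb (λ k → a k + b k) w ≐ lincomb a w +ᵥ lincomb b w
lincomb-distrib-+ a b w t =
  trans (Σᶠ-cong (λ k → ℚₚ.*-distribʳ-+ (w k t) (a k) (b k))) (Σᶠ-distrib-+ (λ k → a k * w k t) (λ k → b k * w k t))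

lincomb-neg : ∀ {n r} (a : Fin r → ℚ) (w : Fin r → Vecℚ n) → lincomb (λ k → - a k) w ≐ -ᵥ lincomb a w
lincomb-neg a w t = trans (Σᶠ-cong (λ k → sym (ℚₚ.neg-distribˡ-* (a k) (w k t)))) (Σᶠ-distrib-neg (λ k → a k * w k t))

lincomb-zero : ∀ {n r} (w : Fin r → Vecℚ n) → lincomb (λ _ → 0ℚ) w ≐ 0ᵥ
lincomb-zero {r = r} w t = trans (Σᶠ-cong (λ k → ℚₚ.*-zeroˡ (w k t))) (Σᶠ-zero r)

-ᵥ≐0⇒≐ : ∀ {n} {x y : Vecℚ n} → y -ᵥ x ≐ 0ᵥ → x ≐ y
-ᵥ≐0⇒≐ {x = x} {y} y-x≐0 t = sym (GroupProperties.x∙y⁻¹≈ε⇒x≈y ℚₚ.+-0-group (y t) (x t) (y-x≐0 t))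

∈ᶠ-resp-≐ : ∀ {n N} {Φ : Fin N → Vecℚ n} {u v} → u ∈ᶠ Φ → u ≐ v → v ∈ᶠ Φ
∈ᶠ-resp-≐ (i , Φi≐u) u≐v = i , ≐.trans Φi≐u u≐v

·ᵥ-cancelˡ : ∀ {n} Q R {u v : Vecℚ n} (0<Q : 0ℚ < Q) →
             Q ·ᵥ u ≐ R ·ᵥ v → u ≐ (R * (1/ Q) {{ℚ.>-nonZero 0<Q}}) ·ᵥ v
·ᵥ-cancelˡ Q R {u} {v} 0<Q Qu≐Rv t = begin
  u t                 ≡⟨ ℚₚ.*-identityˡ (u t) ⟨
  1ℚ * u t            ≡⟨ cong (_* u t) (ℚₚ.*-inverseˡ Q) ⟨
  Q⁻¹ * Q * u t       ≡⟨ ℚₚ.*-assoc Q⁻¹ Q (u t) ⟩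
  Q⁻¹ * (Q * u t)     ≡⟨ cong (Q⁻¹ *_) (Qu≐Rv t) ⟩
  Q⁻¹ * (R * v t)     ≡⟨ solve 3 (λ q r x → q :* (r :* x) := (r :* q) :* x) refl Q⁻¹ R (v t) ⟩
  R * Q⁻¹ * v t       ∎
  where
  open ≡-Reasoning
  instance
    Q≢0 : ℚ.NonZero Q
    Q≢0 = ℚ.>-nonZero 0<Q
  Q⁻¹ = 1/ Q

module ℕΣ = CommutativeMonoidSum ℕₚ.+-0-commutativeMonoid

height : ∀ {r} → (Fin r → ℕ) → ℕ
height = ℕΣ.sum

unit : ∀ {r} → Fin r → Fin r → ℕ
unit zero    zero    = 1
unit zero    (suc _) = 0
unit (suc _) zero    = 0
unit (suc i) (suc k) = unit i k

height-unit : ∀ {r} (i : Fin r) → height (unit i) ≡ 1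
height-unit {suc r} zero    = cong suc (ℕΣ.sum-replicate-zero r)
height-unit         (suc i) = height-unit i

height≡0⇒≡0 : ∀ {r} (c : Fin r → ℕ) → height c ≡ 0 → ∀ k → c k ≡ 0
height≡0⇒≡0 c h≡0 zero    = ℕₚ.m+n≡0⇒m≡0 (c zero) h≡0
height≡0⇒≡0 c h≡0 (suc k) = height≡0⇒≡0 (c ∘ suc) (ℕₚ.m+n≡0⇒n≡0 (c zero) h≡0) k

unit≤ : ∀ {r} (c : Fin r → ℕ) i → 1 ℕ.≤ c i → ∀ k → unit i k ℕ.≤ c k
unit≤ c zero    1≤cᵢ zero    = 1≤cᵢ
unit≤ c zero    _    (suc k) = z≤n
unit≤ c (suc i) _    zero    = z≤n
unit≤ c (suc i) 1≤cᵢ (suc k) = unit≤ (c ∘ suc) i 1≤cᵢ k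

module InnerProductProperties {n : ℕ} (E : InnerProduct n) where
  open InnerProduct E

  private
    ΣΣ-cong : ∀ {f g : Fin n → Fin n → ℚ} → (∀ i j → f i j ≡ g i j) →
              Σᶠ (λ i → Σᶠ (f i)) ≡ Σᶠ (λ i → Σᶠ (g i))
    ΣΣ-cong f≗g = Σᶠ-cong (λ i → Σᶠ-cong (f≗g i))

  ⟪⟫-cong : ∀ {u u′ v v′} → u ≐ u′ → v ≐ v′ → ⟪ u , v ⟫ ≡ ⟪ u′ , v′ ⟫
  ⟪⟫-cong u≐u′ v≐v′ = ΣΣ-cong (λ i j → cong₂ (λ a b → a * gram i j * b) (u≐u′ i) (v≐v′ j))

  ⟪⟫-sym : ∀ u v → ⟪ u , v ⟫ ≡ ⟪ v , u ⟫
  ⟪⟫-sym u v = trans (Σᶠ-comm (λ i j → u i * gram i j * v j)) (ΣΣ-cong (λ i j →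
    trans (cong (λ g → u j * g * v i) (symmetric j i))
          (solve 3 (λ a g b → a :* g :* b := b :* g :* a) refl (u j) (gram i j) (v i))))

  ⟪⟫-distribˡ-+ᵥ : ∀ u u′ v → ⟪ u +ᵥ u′ , v ⟫ ≡ ⟪ u , v ⟫ + ⟪ u′ , v ⟫
  ⟪⟫-distribˡ-+ᵥ u u′ v = begin
    ⟪ u +ᵥ u′ , v ⟫
      ≡⟨ ΣΣ-cong (λ i j → solve 4 (λ a a′ g b → (a :+ a′) :* g :* b := a :* g :* b :+ a′ :* g :* b) refl
                                   (u i) (u′ i) (gram i j) (v j)) ⟩
    Σᶠ (λ i → Σᶠ (λ j → u i * gram i j * v j + u′ i * gram i j * v j))
      ≡⟨ Σᶠ-cong (λ i → Σᶠ-distrib-+ (λ j → u i * gram i j * v j) (λ j → u′ i * gram i j * v j)) ⟩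
    Σᶠ (λ i → Σᶠ (λ j → u i * gram i j * v j) + Σᶠ (λ j → u′ i * gram i j * v j))
      ≡⟨ Σᶠ-distrib-+ (λ i → Σᶠ (λ j → u i * gram i j * v j)) (λ i → Σᶠ (λ j → u′ i * gram i j * v j)) ⟩
    ⟪ u , v ⟫ + ⟪ u′ , v ⟫ ∎
    where open ≡-Reasoning

  ⟪⟫-homoˡ-·ᵥ : ∀ c u v → ⟪ c ·ᵥ u , v ⟫ ≡ c * ⟪ u , v ⟫
  ⟪⟫-homoˡ-·ᵥ c u v = begin
    ⟪ c ·ᵥ u , v ⟫
      ≡⟨ ΣΣ-cong (λ i j → solve 4 (λ c a g b → (c :* a) :* g :* b := c :* (a :* g :* b)) refl c (u i) (gram i j) (v j)) ⟩
    Σᶠ (λ i → Σᶠ (λ j → c * (u i * gram i j * v j)))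
      ≡⟨ Σᶠ-cong (λ i → Σᶠ-distrib-* c (λ j → u i * gram i j * v j)) ⟩
    Σᶠ (λ i → c * Σᶠ (λ j → u i * gram i j * v j))
      ≡⟨ Σᶠ-distrib-* c (λ i → Σᶠ (λ j → u i * gram i j * v j)) ⟩
    c * ⟪ u , v ⟫ ∎
    where open ≡-Reasoning

  ⟪⟫-negˡ : ∀ u v → ⟪ -ᵥ u , v ⟫ ≡ - ⟪ u , v ⟫
  ⟪⟫-negˡ u v = begin
    ⟪ -ᵥ u , v ⟫
      ≡⟨ ΣΣ-cong (λ i j → solve 3 (λ a g b → (:- a) :* g :* b := :- (a :* g :* b)) refl (u i) (gram i j) (v j)) ⟩
    Σᶠ (λ i → Σᶠ (λ j → - (u i * gram i j * v j)))
      ≡⟨ Σᶠ-cong (λ i → Σᶠ-distrib-neg (λ j → u i * gram i j * v j)) ⟩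
    Σᶠ (λ i → - Σᶠ (λ j → u i * gram i j * v j))
      ≡⟨ Σᶠ-distrib-neg (λ i → Σᶠ (λ j → u i * gram i j * v j)) ⟩
    - ⟪ u , v ⟫ ∎
    where open ≡-Reasoning

  ⟪⟫-distribˡ--ᵥ : ∀ u u′ v → ⟪ u -ᵥ u′ , v ⟫ ≡ ⟪ u , v ⟫ - ⟪ u′ , v ⟫
  ⟪⟫-distribˡ--ᵥ u u′ v = trans (⟪⟫-distribˡ-+ᵥ u (-ᵥ u′) v) (cong (⟪ u , v ⟫ +_) (⟪⟫-negˡ u′ v))

  ⟪⟫-distribʳ-+ᵥ : ∀ u v v′ → ⟪ u , v +ᵥ v′ ⟫ ≡ ⟪ u , v ⟫ + ⟪ u , v′ ⟫
  ⟪⟫-distribʳ-+ᵥ u v v′ = trans (⟪⟫-sym u _) (trans (⟪⟫-distribˡ-+ᵥ v v′ u) (cong₂ _+_ (⟪⟫-sym v u) (⟪⟫-sym v′ u)))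

  ⟪⟫-distribʳ--ᵥ : ∀ u v v′ → ⟪ u , v -ᵥ v′ ⟫ ≡ ⟪ u , v ⟫ - ⟪ u , v′ ⟫
  ⟪⟫-distribʳ--ᵥ u v v′ = trans (⟪⟫-sym u _) (trans (⟪⟫-distribˡ--ᵥ v v′ u) (cong₂ _-_ (⟪⟫-sym v u) (⟪⟫-sym v′ u)))

  ⟪⟫-homoʳ-·ᵥ : ∀ c u v → ⟪ u , c ·ᵥ v ⟫ ≡ c * ⟪ u , v ⟫
  ⟪⟫-homoʳ-·ᵥ c u v = trans (⟪⟫-sym u _) (trans (⟪⟫-homoˡ-·ᵥ c v u) (cong (c *_) (⟪⟫-sym v u)))

  ⟪⟫-negʳ : ∀ u v → ⟪ u , -ᵥ v ⟫ ≡ - ⟪ u , v ⟫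
  ⟪⟫-negʳ u v = trans (⟪⟫-sym u _) (trans (⟪⟫-negˡ v u) (cong -_ (⟪⟫-sym v u)))

  ⟪⟫-lincombˡ : ∀ {r} (c : Fin r → ℚ) (w : Fin r → Vecℚ n) v → ⟪ lincomb c w , v ⟫ ≡ Σᶠ (λ k → c k * ⟪ w k , v ⟫)
  ⟪⟫-lincombˡ {zero}  c w v = trans (ΣΣ-cong (λ i j → solve 2 (λ g b → con 0ℚ :* g :* b := con 0ℚ) refl (gram i j) (v j)))
                                    (trans (Σᶠ-cong {n} (λ _ → Σᶠ-zero n)) (Σᶠ-zero n))
  ⟪⟫-lincombˡ {suc r} c w v = begin
    ⟪ lincomb c w , v ⟫
      ≡⟨⟩
    ⟪ (c zero ·ᵥ w zero) +ᵥ lincomb (c ∘ suc) (w ∘ suc) , v ⟫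
      ≡⟨ ⟪⟫-distribˡ-+ᵥ (c zero ·ᵥ w zero) (lincomb (c ∘ suc) (w ∘ suc)) v ⟩
    ⟪ c zero ·ᵥ w zero , v ⟫ + ⟪ lincomb (c ∘ suc) (w ∘ suc) , v ⟫
      ≡⟨ cong₂ _+_ (⟪⟫-homoˡ-·ᵥ (c zero) (w zero) v) (⟪⟫-lincombˡ (c ∘ suc) (w ∘ suc) v) ⟩
    Σᶠ (λ k → c k * ⟪ w k , v ⟫) ∎
    where open ≡-Reasoning

  -- posdef only applies to vectors known to be nonzero; deciding w ≐ 0ᵥ coordinatewise inverts it.
  ⟪⟫≤0⇒≐0 : ∀ w → ⟪ w , w ⟫ ≤ 0ℚ → w ≐ 0ᵥ
  ⟪⟫≤0⇒≐0 w ⟪w,w⟫≤0 with Finₚ.all? (λ i → w i ℚₚ.≟ 0ℚ)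
  ... | yes w≐0 = w≐0
  ... | no  w≉0 = ⊥-elim (<⇒≱ (posdef w w≉0) ⟪w,w⟫≤0)

  cauchySchwarz-equality : ∀ u v → 0ℚ < ⟪ v , v ⟫ → 0ℚ ≤ ⟪ u , v ⟫ * ⟪ u , v ⟫ - ⟪ u , u ⟫ * ⟪ v , v ⟫ →
                           ⟪ v , v ⟫ ·ᵥ u ≐ ⟪ u , v ⟫ ·ᵥ v
  cauchySchwarz-equality u v 0<Q 0≤R²-PQ t = begin
    Q * u t                 ≡⟨ solve 2 (λ x y → x := (x :- y) :+ y) refl (Q * u t) (R * v t) ⟩
    w t + R * v t           ≡⟨ cong (_+ R * v t) (⟪⟫≤0⇒≐0 w ⟪w,w⟫≤0 t) ⟩
    0ℚ + R * v t            ≡⟨ ℚₚ.+-identityˡ (R * v t) ⟩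
    R * v t                 ∎
    where
    open ≡-Reasoning
    P = ⟪ u , u ⟫
    Q = ⟪ v , v ⟫
    R = ⟪ u , v ⟫
    w = (Q ·ᵥ u) -ᵥ (R ·ᵥ v)
    ⟪w,w⟫≡ : ⟪ w , w ⟫ ≡ - (Q * (R * R - P * Q))
    ⟪w,w⟫≡ = begin
      ⟪ w , w ⟫
        ≡⟨ ⟪⟫-distribˡ--ᵥ (Q ·ᵥ u) (R ·ᵥ v) w ⟩
      ⟪ Q ·ᵥ u , w ⟫ - ⟪ R ·ᵥ v , w ⟫
        ≡⟨ cong₂ _-_ (⟪⟫-homoˡ-·ᵥ Q u w) (⟪⟫-homoˡ-·ᵥ R v w) ⟩
      Q * ⟪ u , w ⟫ - R * ⟪ v , w ⟫
        ≡⟨ cong₂ (λ x y → Q * x - R * y)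
             (trans (⟪⟫-distribʳ--ᵥ u (Q ·ᵥ u) (R ·ᵥ v)) (cong₂ _-_ (⟪⟫-homoʳ-·ᵥ Q u u) (⟪⟫-homoʳ-·ᵥ R u v)))
             (trans (⟪⟫-distribʳ--ᵥ v (Q ·ᵥ u) (R ·ᵥ v)) (cong₂ _-_ (trans (⟪⟫-homoʳ-·ᵥ Q v u) (cong (Q *_) (⟪⟫-sym v u)))
                                                                  (⟪⟫-homoʳ-·ᵥ R v v))) ⟩
      Q * (Q * P - R * R) - R * (Q * R - R * Q)
        ≡⟨ solve 3 (λ P Q R → Q :* (Q :* P :- R :* R) :- R :* (Q :* R :- R :* Q) := :- (Q :* (R :* R :- P :* Q))) refl P Q R ⟩
      - (Q * (R * R - P * Q)) ∎
    ⟪w,w⟫≤0 : ⟪ w , w ⟫ ≤ 0ℚ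
    ⟪w,w⟫≤0 = subst (_≤ 0ℚ) (sym ⟪w,w⟫≡) (neg-nonPos (*-nonNeg (ℚₚ.<⇒≤ 0<Q) 0≤R²-PQ))

module RootSystemProperties {n N : ℕ} (E : InnerProduct n) {Φ : Fin N → Vecℚ n} (RS : IsRootSystem E Φ) where
  open InnerProduct E
  open InnerProductProperties E
  open IsRootSystem RS

  RootOrZero : Vecℚ n → Set
  RootOrZero v = v ∈ᶠ Φ ⊎ v ≐ 0ᵥ

  RootOrZero-resp : ∀ {u v} → u ≐ v → RootOrZero u → RootOrZero v
  RootOrZero-resp u≐v (inj₁ u∈Φ) = inj₁ (∈ᶠ-resp-≐ u∈Φ u≐v)
  RootOrZero-resp u≐v (inj₂ u≐0) = inj₂ (≐.trans (≐.sym u≐v) u≐0)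

  root≉0 : ∀ {u} → u ∈ᶠ Φ → ¬ u ≐ 0ᵥ
  root≉0 (i , Φi≐u) u≐0 = nonzero i (≐.trans Φi≐u u≐0)

  root⇒⟪⟫-pos : ∀ {u} → u ∈ᶠ Φ → 0ℚ < ⟪ u , u ⟫
  root⇒⟪⟫-pos {u} u∈Φ = posdef u (root≉0 u∈Φ)

  -ᵥ-root : ∀ {u} → u ∈ᶠ Φ → -ᵥ u ∈ᶠ Φ
  -ᵥ-root {u} (i , Φi≐u) with crystallographic i i
  ... | k , 2P≡kP , sᵢΦi∈Φ = ∈ᶠ-resp-≐ sᵢΦi∈Φ (λ t → begin
    Φ i t - ℤtoℚ k * Φ i t         ≡⟨ cong (λ c → Φ i t - c * Φ i t) k≡2 ⟨
    Φ i t - ℕtoℚ 2 * Φ i t         ≡⟨ solve 1 (λ x → x :- (con 1ℚ :+ con 1ℚ) :* x := :- x) refl (Φ i t) ⟩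
    - Φ i t                        ≡⟨ cong -_ (Φi≐u t) ⟩
    - u t                          ∎)
    where
    open ≡-Reasoning
    k≡2 : ℕtoℚ 2 ≡ ℤtoℚ k
    k≡2 = *-cancelʳ-≡-pos (root⇒⟪⟫-pos (i , ≐.refl)) 2P≡kP

  positive-multiple⇒≐ : ∀ i j c → 0ℚ < c → Φ i ≐ c ·ᵥ Φ j → Φ i ≐ Φ j
  positive-multiple⇒≐ i j c 0<c Φi≐cΦj with reduced j c (i , Φi≐cΦj)
  ... | inj₁ c≡1  = λ t → trans (Φi≐cΦj t) (trans (cong (_* Φ j t) c≡1) (ℚₚ.*-identityˡ (Φ j t)))
  ... | inj₂ c≡-1 = ⊥-elim (<⇒≱ 0<c (subst (_≤ 0ℚ) (sym c≡-1) (ℚₚ.<⇒≤ (ℚₚ.negative⁻¹ _))))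

  -- Cartan integers 2 + m and 2 + m′ give ⟪Φ i, Φ j⟫² ≥ ‖Φ i‖² ‖Φ j‖², the equality case of
  -- Cauchy–Schwarz, so Φ i is a positive multiple of Φ j.
  cartan≥2⇒≐ : ∀ i j m m′ → 0ℚ < ⟪ Φ i , Φ j ⟫ →
               ℤtoℚ (ℤ.+ 2) * ⟪ Φ j , Φ i ⟫ ≡ ℤtoℚ (ℤ.+ (2 ℕ.+ m)) * ⟪ Φ i , Φ i ⟫ →
               ℤtoℚ (ℤ.+ 2) * ⟪ Φ i , Φ j ⟫ ≡ ℤtoℚ (ℤ.+ (2 ℕ.+ m′)) * ⟪ Φ j , Φ j ⟫ →
               Φ i ≐ Φ j
  cartan≥2⇒≐ i j m m′ 0<R 2R≡[2+m]P 2R≡[2+m′]Q =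
    positive-multiple⇒≐ i j _ (*-pos 0<R (ℚₚ.positive⁻¹ _ {{ℚₚ.1/pos⇒pos Q {{ℚ.positive 0<Q}}}}))
      (·ᵥ-cancelˡ Q R 0<Q (cauchySchwarz-equality (Φ i) (Φ j) 0<Q R²≥PQ))
    where
    P = ⟪ Φ i , Φ i ⟫
    Q = ⟪ Φ j , Φ j ⟫
    R = ⟪ Φ i , Φ j ⟫
    0<Q : 0ℚ < Q
    0<Q = root⇒⟪⟫-pos (j , ≐.refl)
    R²≥PQ : 0ℚ ≤ R * R - P * Q
    R²≥PQ = reverse-cauchySchwarz {R = R} (ℚₚ.<⇒≤ (root⇒⟪⟫-pos (i , ≐.refl))) (ℚₚ.<⇒≤ 0<Q) (ℕtoℚ-nonNeg m) (ℕtoℚ-nonNeg m′)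
      (trans (cong (ℕtoℚ 2 *_) (⟪⟫-sym (Φ i) (Φ j))) (trans 2R≡[2+m]P (cong (_* P) (ℕtoℚ-+ 2 m))))
      (trans 2R≡[2+m′]Q (cong (_* Q) (ℕtoℚ-+ 2 m′)))

  -- k = ⟨Φ i, Φ j^∨⟩ and k′ = ⟨Φ j, Φ i^∨⟩; a Cartan integer 1 makes the reflection of one root in
  -- the other equal to ±(Φ i − Φ j).
  private
    difference-by-cartan : ∀ i j → 0ℚ < ⟪ Φ i , Φ j ⟫ →
      ∀ k → ℤtoℚ (ℤ.+ 2) * ⟪ Φ j , Φ i ⟫ ≡ ℤtoℚ k * ⟪ Φ i , Φ i ⟫ → (Φ j -ᵥ (ℤtoℚ k ·ᵥ Φ i)) ∈ᶠ Φ →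
      ∀ k′ → ℤtoℚ (ℤ.+ 2) * ⟪ Φ i , Φ j ⟫ ≡ ℤtoℚ k′ * ⟪ Φ j , Φ j ⟫ → (Φ i -ᵥ (ℤtoℚ k′ ·ᵥ Φ j)) ∈ᶠ Φ →
      (∃ λ m → k ≡ ℤ.+ suc m) → (∃ λ m′ → k′ ≡ ℤ.+ suc m′) → RootOrZero (Φ i -ᵥ Φ j)
    difference-by-cartan i j 0<R k _ _ .(ℤ.+ 1) _ sⱼΦi∈Φ _ (zero , refl) =
      inj₁ (∈ᶠ-resp-≐ sⱼΦi∈Φ (λ t → cong (λ x → Φ i t - x) (ℚₚ.*-identityˡ (Φ j t))))
    difference-by-cartan i j 0<R .(ℤ.+ 1) _ sᵢΦj∈Φ _ _ _ (zero , refl) (suc _ , refl) =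
      inj₁ (∈ᶠ-resp-≐ (-ᵥ-root sᵢΦj∈Φ) (λ t → solve 2 (λ x y → :- (y :- con 1ℚ :* x) := x :- y) refl (Φ i t) (Φ j t)))
    difference-by-cartan i j 0<R _ 2R≡kP _ _ 2R≡k′Q _ (suc m , refl) (suc m′ , refl) =
      inj₂ (λ t → trans (cong (_- Φ j t) (cartan≥2⇒≐ i j m m′ 0<R 2R≡kP 2R≡k′Q t)) (ℚₚ.+-inverseʳ (Φ j t)))

    ⟪Φ⟫-pos⇒difference : ∀ i j → 0ℚ < ⟪ Φ i , Φ j ⟫ → RootOrZero (Φ i -ᵥ Φ j)
    ⟪Φ⟫-pos⇒difference i j 0<R =
      let k  , 2R≡kP  , sᵢΦj∈Φ = crystallographic i j
          k′ , 2R≡k′Q , sⱼΦi∈Φ = crystallographic j i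
      in difference-by-cartan i j 0<R k 2R≡kP sᵢΦj∈Φ k′ 2R≡k′Q sⱼΦi∈Φ
           (cartanInteger-pos k (root⇒⟪⟫-pos (i , ≐.refl)) (subst (0ℚ <_) (⟪⟫-sym (Φ i) (Φ j)) 0<R) 2R≡kP)
           (cartanInteger-pos k′ (root⇒⟪⟫-pos (j , ≐.refl)) 0<R 2R≡k′Q)

  ⟪⟫-pos⇒difference : ∀ {u v} → u ∈ᶠ Φ → v ∈ᶠ Φ → 0ℚ < ⟪ u , v ⟫ → RootOrZero (u -ᵥ v)
  ⟪⟫-pos⇒difference (i , Φi≐u) (j , Φj≐v) 0<⟪u,v⟫ =
    RootOrZero-resp (λ t → cong₂ _-_ (Φi≐u t) (Φj≐v t))
      (⟪Φ⟫-pos⇒difference i j (subst (0ℚ <_) (sym (⟪⟫-cong Φi≐u Φj≐v)) 0<⟪u,v⟫))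

  ⟪⟫-neg⇒sum : ∀ {u v} → u ∈ᶠ Φ → v ∈ᶠ Φ → ⟪ u , v ⟫ < 0ℚ → RootOrZero (u +ᵥ v)
  ⟪⟫-neg⇒sum {u} {v} u∈Φ v∈Φ ⟪u,v⟫<0 =
    RootOrZero-resp (λ t → solve 2 (λ x y → x :- (:- y) := x :+ y) refl (u t) (v t))
      (⟪⟫-pos⇒difference u∈Φ (-ᵥ-root v∈Φ) (subst (0ℚ <_) (sym (⟪⟫-negʳ u v)) (ℚₚ.neg-antimono-< ⟪u,v⟫<0)))

  -- If neither ⟪β, δ⟫ nor ⟪γ, δ⟫ is positive, then ⟪s, β⟫ + ⟪s, γ⟫ = ‖β + γ‖² − ⟪β + γ, δ⟫ > 0
  -- for s = β + γ − δ, and s − β = γ − δ or s − γ = β − δ.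
  peel : ∀ {β γ δ} → β ∈ᶠ Φ → γ ∈ᶠ Φ → (β +ᵥ γ) ∈ᶠ Φ → δ ∈ᶠ Φ → ((β +ᵥ γ) -ᵥ δ) ∈ᶠ Φ →
         RootOrZero (β -ᵥ δ) ⊎ RootOrZero (γ -ᵥ δ)
  peel {β} {γ} {δ} β∈Φ γ∈Φ θ∈Φ δ∈Φ s∈Φ with 0ℚ ℚₚ.<? ⟪ β , δ ⟫ | 0ℚ ℚₚ.<? ⟪ γ , δ ⟫
  ... | yes 0<⟪β,δ⟫ | _ = inj₁ (⟪⟫-pos⇒difference β∈Φ δ∈Φ 0<⟪β,δ⟫)
  ... | no _ | yes 0<⟪γ,δ⟫ = inj₂ (⟪⟫-pos⇒difference γ∈Φ δ∈Φ 0<⟪γ,δ⟫)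
  ... | no 0≮⟪β,δ⟫ | no 0≮⟪γ,δ⟫ with 0ℚ ℚₚ.<? ⟪ (β +ᵥ γ) -ᵥ δ , β ⟫
  ...   | yes 0<⟪s,β⟫ = inj₂ (RootOrZero-resp (λ t → solve 3 (λ b g d → ((b :+ g) :- d) :- b := g :- d) refl (β t) (γ t) (δ t))
                                             (⟪⟫-pos⇒difference s∈Φ β∈Φ 0<⟪s,β⟫))
  ...   | no 0≮⟪s,β⟫ = inj₁ (RootOrZero-resp (λ t → solve 3 (λ b g d → ((b :+ g) :- d) :- g := b :- d) refl (β t) (γ t) (δ t))
                                            (⟪⟫-pos⇒difference s∈Φ γ∈Φ 0<⟪s,γ⟫))
    where
    open ≡-Reasoning
    θ = β +ᵥ γ
    s = θ -ᵥ δ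
    ⟪s,γ⟫≡ : ⟪ s , γ ⟫ ≡ ⟪ θ , θ ⟫ + - ⟪ β , δ ⟫ + - ⟪ γ , δ ⟫ + - ⟪ s , β ⟫
    ⟪s,γ⟫≡ = begin
      ⟪ s , γ ⟫                                        ≡⟨ solve 2 (λ x y → y := (x :+ y) :+ :- x) refl ⟪ s , β ⟫ ⟪ s , γ ⟫ ⟩
      ⟪ s , β ⟫ + ⟪ s , γ ⟫ + - ⟪ s , β ⟫              ≡⟨ cong (_+ - ⟪ s , β ⟫) (sym (⟪⟫-distribʳ-+ᵥ s β γ)) ⟩
      ⟪ s , θ ⟫ + - ⟪ s , β ⟫                          ≡⟨ cong (_+ - ⟪ s , β ⟫) (⟪⟫-distribˡ--ᵥ θ δ θ) ⟩
      ⟪ θ , θ ⟫ - ⟪ δ , θ ⟫ + - ⟪ s , β ⟫              ≡⟨ cong (λ x → ⟪ θ , θ ⟫ - x + - ⟪ s , β ⟫)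
                                                           (trans (⟪⟫-distribʳ-+ᵥ δ β γ) (cong₂ _+_ (⟪⟫-sym δ β) (⟪⟫-sym δ γ))) ⟩
      ⟪ θ , θ ⟫ - (⟪ β , δ ⟫ + ⟪ γ , δ ⟫) + - ⟪ s , β ⟫
        ≡⟨ solve 4 (λ N b g x → N :- (b :+ g) :+ :- x := N :+ :- b :+ :- g :+ :- x) refl ⟪ θ , θ ⟫ ⟪ β , δ ⟫ ⟪ γ , δ ⟫ ⟪ s , β ⟫ ⟩
      ⟪ θ , θ ⟫ + - ⟪ β , δ ⟫ + - ⟪ γ , δ ⟫ + - ⟪ s , β ⟫ ∎
    0<⟪s,γ⟫ : 0ℚ < ⟪ s , γ ⟫
    0<⟪s,γ⟫ = subst (0ℚ <_) (sym ⟪s,γ⟫≡)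
      (ℚₚ.+-mono-<-≤ (ℚₚ.+-mono-<-≤ (ℚₚ.+-mono-<-≤ (root⇒⟪⟫-pos θ∈Φ)
        (neg-nonNeg (ℚₚ.≮⇒≥ 0≮⟪β,δ⟫))) (neg-nonNeg (ℚₚ.≮⇒≥ 0≮⟪γ,δ⟫))) (neg-nonNeg (ℚₚ.≮⇒≥ 0≮⟪s,β⟫)))

module BaseProperties {n N r : ℕ} (E : InnerProduct n) {Φ : Fin N → Vecℚ n} {Δ : Fin r → Vecℚ n}
                      (RS : IsRootSystem E Φ) (B : IsBase Φ Δ) where
  open InnerProduct E
  open InnerProductProperties E
  open RootSystemProperties E RS
  open IsBase B

  ⟦_⟧ : (Fin r → ℕ) → Vecℚ n
  ⟦ c ⟧ = lincomb (ℕtoℚ ∘ c) Δ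

  ⟦⟧-+ : ∀ a b → ⟦ (λ k → a k ℕ.+ b k) ⟧ ≐ ⟦ a ⟧ +ᵥ ⟦ b ⟧
  ⟦⟧-+ a b = ≐.trans (lincomb-cong Δ (λ k → ℕtoℚ-+ (a k) (b k))) (lincomb-distrib-+ (ℕtoℚ ∘ a) (ℕtoℚ ∘ b) Δ)

  ⟦⟧-zero : ∀ c → (∀ k → c k ≡ 0) → ⟦ c ⟧ ≐ 0ᵥ
  ⟦⟧-zero c c≗0 = ≐.trans (lincomb-cong Δ (λ k → cong ℕtoℚ (c≗0 k))) (lincomb-zero Δ)

  ⟦unit⟧ : ∀ i → ⟦ unit i ⟧ ≐ Δ i
  ⟦unit⟧ i = go i Δ
    where
    go : ∀ {r} (i : Fin r) (w : Fin r → Vecℚ n) → lincomb (ℕtoℚ ∘ unit i) w ≐ w i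
    go zero    w t = trans (cong₂ _+_ (ℚₚ.*-identityˡ (w zero t)) (lincomb-zero (w ∘ suc) t)) (ℚₚ.+-identityʳ (w zero t))
    go (suc i) w t = trans (cong (_+ lincomb (ℕtoℚ ∘ unit i) (w ∘ suc) t) (ℚₚ.*-zeroˡ (w zero t)))
                           (trans (ℚₚ.+-identityˡ _) (go i (w ∘ suc) t))

  ⟦⟧-injective : ∀ a b → ⟦ a ⟧ ≐ ⟦ b ⟧ → ∀ k → a k ≡ b k
  ⟦⟧-injective a b ⟦a⟧≐⟦b⟧ k =
    ℕtoℚ-injective (GroupProperties.x∙y⁻¹≈ε⇒x≈y ℚₚ.+-0-group _ _ (independent (λ k → ℕtoℚ (a k) - ℕtoℚ (b k)) diff≐0 k))
    where
    diff≐0 : lincomb (λ k → ℕtoℚ (a k) - ℕtoℚ (b k)) Δ ≐ 0ᵥ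
    diff≐0 t = begin
      lincomb (λ k → ℕtoℚ (a k) - ℕtoℚ (b k)) Δ t ≡⟨ lincomb-distrib-+ (ℕtoℚ ∘ a) (λ k → - ℕtoℚ (b k)) Δ t ⟩
      ⟦ a ⟧ t + lincomb (λ k → - ℕtoℚ (b k)) Δ t   ≡⟨ cong₂ _+_ (⟦a⟧≐⟦b⟧ t) (lincomb-neg (ℕtoℚ ∘ b) Δ t) ⟩
      ⟦ b ⟧ t - ⟦ b ⟧ t                            ≡⟨ ℚₚ.+-inverseʳ (⟦ b ⟧ t) ⟩
      0ℚ                                          ∎
      where open ≡-Reasoning

  ⟦⟧≐0⇒≡0 : ∀ c → ⟦ c ⟧ ≐ 0ᵥ → ∀ k → c k ≡ 0
  ⟦⟧≐0⇒≡0 c ⟦c⟧≐0 = ⟦⟧-injective c (λ _ → 0) (≐.trans ⟦c⟧≐0 (≐.sym (⟦⟧-zero (λ _ → 0) (λ _ → refl))))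

  ℕΔ : Vecℚ n → Set
  ℕΔ = NonnegComb Φ Δ

  Φ⁺ : Vecℚ n → Set
  Φ⁺ = Positive Φ Δ

  Φ⁺₀ : Vecℚ n → Set
  Φ⁺₀ v = Φ⁺ v ⊎ v ≐ 0ᵥ

  _≼Δ_ : Vecℚ n → Vecℚ n → Set
  _≼Δ_ = _≼_ Φ Δ

  ℕΔ-resp : ∀ {u v} → u ≐ v → ℕΔ u → ℕΔ v
  ℕΔ-resp u≐v (c , u≐⟦c⟧) = c , ≐.trans (≐.sym u≐v) u≐⟦c⟧

  Φ⁺-resp : ∀ {u v} → u ≐ v → Φ⁺ u → Φ⁺ v
  Φ⁺-resp u≐v (u∈Φ , u∈ℕΔ) = ∈ᶠ-resp-≐ u∈Φ u≐v , ℕΔ-resp u≐v u∈ℕΔ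

  ℕΔ-+ : ∀ {u v} → ℕΔ u → ℕΔ v → ℕΔ (u +ᵥ v)
  ℕΔ-+ (a , u≐⟦a⟧) (b , v≐⟦b⟧) = (λ k → a k ℕ.+ b k) , λ t → trans (cong₂ _+_ (u≐⟦a⟧ t) (v≐⟦b⟧ t)) (sym (⟦⟧-+ a b t))

  simple∈ℕΔ : ∀ i → ℕΔ (Δ i)
  simple∈ℕΔ i = unit i , ≐.sym (⟦unit⟧ i)

  ℕΔ∩-ℕΔ⇒≐0 : ∀ {x} → ℕΔ x → ℕΔ (-ᵥ x) → x ≐ 0ᵥ
  ℕΔ∩-ℕΔ⇒≐0 {x} (a , x≐⟦a⟧) (b , -x≐⟦b⟧) =
    ≐.trans x≐⟦a⟧ (⟦⟧-zero a (λ k → ℕₚ.m+n≡0⇒m≡0 (a k) (⟦⟧≐0⇒≡0 (λ k → a k ℕ.+ b k) ⟦a+b⟧≐0 k)))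
    where
    ⟦a+b⟧≐0 : ⟦ (λ k → a k ℕ.+ b k) ⟧ ≐ 0ᵥ
    ⟦a+b⟧≐0 t = trans (⟦⟧-+ a b t) (trans (cong₂ _+_ (sym (x≐⟦a⟧ t)) (sym (-x≐⟦b⟧ t))) (ℚₚ.+-inverseʳ (x t)))

  Φ⁺⇒¬ℕΔ- : ∀ {α} → Φ⁺ α → ¬ ℕΔ (-ᵥ α)
  Φ⁺⇒¬ℕΔ- (α∈Φ , α∈ℕΔ) -α∈ℕΔ = root≉0 α∈Φ (ℕΔ∩-ℕΔ⇒≐0 α∈ℕΔ -α∈ℕΔ)

  root⇒ℕΔ⊎ℕΔ- : ∀ {u} → u ∈ᶠ Φ → ℕΔ u ⊎ ℕΔ (-ᵥ u)
  root⇒ℕΔ⊎ℕΔ- (j , Φj≐u) = Sum.map (ℕΔ-resp Φj≐u) (ℕΔ-resp (λ t → cong -_ (Φj≐u t)) ∘ negate) (spans j)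
    where
    negate : (∃ λ c → Φ j ≐ lincomb (λ k → ℤtoℚ (ℤ.- (ℤ.+ c k))) Δ) → ℕΔ (-ᵥ Φ j)
    negate (c , Φj≐-⟦c⟧) = c , λ t → begin
      - Φ j t                                          ≡⟨ cong -_ (Φj≐-⟦c⟧ t) ⟩
      - lincomb (λ k → ℤtoℚ (ℤ.- (ℤ.+ c k))) Δ t       ≡⟨ cong -_ (lincomb-cong Δ (λ k → ℤtoℚ-neg (c k)) t) ⟩
      - lincomb (λ k → - ℕtoℚ (c k)) Δ t               ≡⟨ cong -_ (lincomb-neg (ℕtoℚ ∘ c) Δ t) ⟩
      - - ⟦ c ⟧ t                                      ≡⟨ GroupProperties.⁻¹-involutive ℚₚ.+-0-group (⟦ c ⟧ t) ⟩
      ⟦ c ⟧ t                                          ∎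
      where open ≡-Reasoning

  ℕΔ-below-simple : ∀ {x} i → ℕΔ x → ℕΔ (Δ i -ᵥ x) → x ≐ 0ᵥ ⊎ Δ i -ᵥ x ≐ 0ᵥ
  ℕΔ-below-simple {x} i (a , x≐⟦a⟧) (b , Δi-x≐⟦b⟧) with height a in ha
  ... | zero  = inj₁ (≐.trans x≐⟦a⟧ (⟦⟧-zero a (height≡0⇒≡0 a ha)))
  ... | suc m = inj₂ (≐.trans Δi-x≐⟦b⟧ (⟦⟧-zero b (height≡0⇒≡0 b hb≡0)))
    where
    a+b≗unit : ∀ k → a k ℕ.+ b k ≡ unit i k
    a+b≗unit = ⟦⟧-injective (λ k → a k ℕ.+ b k) (unit i) (λ t → begin
      ⟦ (λ k → a k ℕ.+ b k) ⟧ t   ≡⟨ ⟦⟧-+ a b t ⟩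
      ⟦ a ⟧ t + ⟦ b ⟧ t           ≡⟨ cong₂ _+_ (x≐⟦a⟧ t) (Δi-x≐⟦b⟧ t) ⟨
      x t + (Δ i t - x t)         ≡⟨ solve 2 (λ x d → x :+ (d :- x) := d) refl (x t) (Δ i t) ⟩
      Δ i t                       ≡⟨ ⟦unit⟧ i t ⟨
      ⟦ unit i ⟧ t                ∎)
      where open ≡-Reasoning
    ha+hb≡1 : suc m ℕ.+ height b ≡ 1
    ha+hb≡1 = begin
      suc m ℕ.+ height b                  ≡⟨ cong (ℕ._+ height b) ha ⟨
      height a ℕ.+ height b               ≡⟨ ℕΣ.∑-distrib-+ a b ⟨
      height (λ k → a k ℕ.+ b k)          ≡⟨ ℕΣ.sum-cong-≗ a+b≗unit ⟩
      height (unit i)                     ≡⟨ height-unit i ⟩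
      1                                   ∎
      where open ≡-Reasoning
    hb≡0 : height b ≡ 0
    hb≡0 = ℕₚ.m+n≡0⇒n≡0 m (ℕₚ.suc-injective ha+hb≡1)

  Φ⁺-minus-simple : ∀ {x} i → Φ⁺ x → RootOrZero (x -ᵥ Δ i) → Φ⁺₀ (x -ᵥ Δ i)
  Φ⁺-minus-simple i _ (inj₂ x-Δᵢ≐0) = inj₂ x-Δᵢ≐0
  Φ⁺-minus-simple {x} i (x∈Φ , x∈ℕΔ) (inj₁ x-Δᵢ∈Φ) =
    Sum.[ (λ x-Δᵢ∈ℕΔ → inj₁ (x-Δᵢ∈Φ , x-Δᵢ∈ℕΔ)) , below-Δᵢ ] (root⇒ℕΔ⊎ℕΔ- x-Δᵢ∈Φ)
    where
    below-Δᵢ : ℕΔ (-ᵥ (x -ᵥ Δ i)) → Φ⁺₀ (x -ᵥ Δ i)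
    below-Δᵢ Δᵢ-x∈ℕΔ =
      Sum.[ (λ x≐0 → ⊥-elim (root≉0 x∈Φ x≐0))
          , (λ Δᵢ-x≐0 → inj₂ (λ t → trans (solve 2 (λ x d → x :- d := :- (d :- x)) refl (x t) (Δ i t)) (cong -_ (Δᵢ-x≐0 t)))) ]
        (ℕΔ-below-simple i x∈ℕΔ (ℕΔ-resp (λ t → solve 2 (λ x d → :- (x :- d) := d :- x) refl (x t) (Δ i t)) Δᵢ-x∈ℕΔ))

  ≼-refl : ∀ {x} → x ≼Δ x
  ≼-refl {x} = (λ _ → 0) , λ t → trans (ℚₚ.+-inverseʳ (x t)) (sym (⟦⟧-zero (λ _ → 0) (λ _ → refl) t))

  ≼-trans : ∀ {x y z} → x ≼Δ y → y ≼Δ z → x ≼Δ z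
  ≼-trans {x} {y} {z} x≼y y≼z = ℕΔ-resp (λ t → solve 3 (λ x y z → (z :- y) :+ (y :- x) := z :- x) refl (x t) (y t) (z t))
                                       (ℕΔ-+ y≼z x≼y)

  minus-simple-≼ : ∀ x i → (x -ᵥ Δ i) ≼Δ x
  minus-simple-≼ x i = ℕΔ-resp (λ t → solve 2 (λ x d → d := x :- (x :- d)) refl (x t) (Δ i t)) (simple∈ℕΔ i)

  record Gap (h : ℕ) (x y : Vecℚ n) : Set where
    constructor gap
    field
      coeffs   : Fin r → ℕ
      coeffs≐  : y -ᵥ x ≐ ⟦ coeffs ⟧
      height≡  : height coeffs ≡ h

  Gap⇒≼ : ∀ {h x y} → Gap h x y → x ≼Δ y
  Gap⇒≼ (gap c y-x≐⟦c⟧ _) = c , y-x≐⟦c⟧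

  Gap-cong : ∀ {h x y x′ y′} → y -ᵥ x ≐ y′ -ᵥ x′ → Gap h x y → Gap h x′ y′
  Gap-cong eq (gap c y-x≐⟦c⟧ hc) = gap c (≐.trans (≐.sym eq) y-x≐⟦c⟧) hc

  Gap-congʳ : ∀ {h x y y′} → y ≐ y′ → Gap h x y → Gap h x y′
  Gap-congʳ {x = x} y≐y′ = Gap-cong (λ t → cong (_- x t) (y≐y′ t))

  Gap-zero : ∀ {x y} → Gap 0 x y → y -ᵥ x ≐ 0ᵥ
  Gap-zero (gap c y-x≐⟦c⟧ hc≡0) = ≐.trans y-x≐⟦c⟧ (⟦⟧-zero c (height≡0⇒≡0 c hc≡0))

  Gap-shift : ∀ {h x y} k → Gap h (x +ᵥ Δ k) y → Gap h x (y -ᵥ Δ k)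
  Gap-shift {x = x} {y} k = Gap-cong (λ t → solve 3 (λ x y d → y :- (x :+ d) := (y :- d) :- x) refl (x t) (y t) (Δ k t))

  Gap-step-up : ∀ {h x y} k → Gap h (x +ᵥ Δ k) y → Gap (suc h) x y
  Gap-step-up {h} {x} {y} k (gap c eq hc) = gap (λ k′ → c k′ ℕ.+ unit k k′) eq′ hc′
    where
    eq′ : y -ᵥ x ≐ ⟦ (λ k′ → c k′ ℕ.+ unit k k′) ⟧
    eq′ t = begin
      y t - x t                        ≡⟨ solve 3 (λ y x d → y :- x := (y :- (x :+ d)) :+ d) refl (y t) (x t) (Δ k t) ⟩
      (y t - (x t + Δ k t)) + Δ k t    ≡⟨ cong₂ _+_ (eq t) (sym (⟦unit⟧ k t)) ⟩
      ⟦ c ⟧ t + ⟦ unit k ⟧ t           ≡⟨ ⟦⟧-+ c (unit k) t ⟨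
      ⟦ (λ k′ → c k′ ℕ.+ unit k k′) ⟧ t ∎
      where open ≡-Reasoning
    hc′ : height (λ k′ → c k′ ℕ.+ unit k k′) ≡ suc h
    hc′ = trans (ℕΣ.∑-distrib-+ c (unit k)) (trans (cong₂ ℕ._+_ hc (height-unit k)) (ℕₚ.+-comm h 1))

  Gap-step-down : ∀ {h x y} c → y -ᵥ x ≐ ⟦ c ⟧ → height c ≡ suc h → ∀ k → 1 ℕ.≤ c k → Gap h (x +ᵥ Δ k) y
  Gap-step-down {h} {x} {y} c y-x≐⟦c⟧ hc k 1≤cₖ = gap c′ eq hc′
    where
    c′ : Fin r → ℕ
    c′ k′ = c k′ ℕ.∸ unit k k′
    c′+unit≗c : ∀ k′ → c′ k′ ℕ.+ unit k k′ ≡ c k′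
    c′+unit≗c k′ = ℕₚ.m∸n+n≡m (unit≤ c k 1≤cₖ k′)
    eq : y -ᵥ (x +ᵥ Δ k) ≐ ⟦ c′ ⟧
    eq t = begin
      y t - (x t + Δ k t)          ≡⟨ solve 3 (λ y x d → y :- (x :+ d) := (y :- x) :- d) refl (y t) (x t) (Δ k t) ⟩
      (y t - x t) - Δ k t          ≡⟨ cong (_- Δ k t) (y-x≐⟦c⟧ t) ⟩
      ⟦ c ⟧ t - Δ k t              ≡⟨ cong (_- Δ k t) (lincomb-cong Δ (λ k′ → cong ℕtoℚ (c′+unit≗c k′)) t) ⟨
      ⟦ (λ k′ → c′ k′ ℕ.+ unit k k′) ⟧ t - Δ k t ≡⟨ cong (_- Δ k t) (trans (⟦⟧-+ c′ (unit k) t) (cong (⟦ c′ ⟧ t +_) (⟦unit⟧ k t))) ⟩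
      (⟦ c′ ⟧ t + Δ k t) - Δ k t   ≡⟨ solve 2 (λ a d → (a :+ d) :- d := a) refl (⟦ c′ ⟧ t) (Δ k t) ⟩
      ⟦ c′ ⟧ t                     ∎
      where open ≡-Reasoning
    hc′ : height c′ ≡ h
    hc′ = ℕₚ.+-cancelʳ-≡ 1 (height c′) h (begin
      height c′ ℕ.+ 1                          ≡⟨ cong (height c′ ℕ.+_) (height-unit k) ⟨
      height c′ ℕ.+ height (unit k)            ≡⟨ ℕΣ.∑-distrib-+ c′ (unit k) ⟨
      height (λ k′ → c′ k′ ℕ.+ unit k k′)       ≡⟨ ℕΣ.sum-cong-≗ c′+unit≗c ⟩
      height c                                 ≡⟨ hc ⟩
      suc h                                    ≡⟨ ℕₚ.+-comm 1 h ⟩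
      h ℕ.+ 1                                  ∎)
      where open ≡-Reasoning

  Gap-suc⇒≉ : ∀ {h x y} → Gap (suc h) x y → ¬ y -ᵥ x ≐ 0ᵥ
  Gap-suc⇒≉ (gap c y-x≐⟦c⟧ hc) y-x≐0 = ℕₚ.0≢1+n (trans (sym hc≡0) hc)
    where
    hc≡0 : height c ≡ 0
    hc≡0 = trans (ℕΣ.sum-cong-≗ (⟦⟧≐0⇒≡0 c (≐.trans (≐.sym y-x≐⟦c⟧) y-x≐0))) (ℕΣ.sum-replicate-zero r)

  ∃simple-direction : ∀ {w} c → w ≐ ⟦ c ⟧ → ¬ w ≐ 0ᵥ → ∃ λ k → 1 ℕ.≤ c k × 0ℚ < ⟪ Δ k , w ⟫
  ∃simple-direction {w} c w≐⟦c⟧ w≉0 =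
    let k , 0<cₖ⟪Δₖ,w⟫ = Σᶠ-pos⇒∃pos (λ k → ℕtoℚ (c k) * ⟪ Δ k , w ⟫) (subst (0ℚ <_) ⟪w,w⟫≡ (posdef w w≉0))
    in  k , ℕtoℚ*-pos⇒ (c k) ⟪ Δ k , w ⟫ 0<cₖ⟪Δₖ,w⟫
    where
    ⟪w,w⟫≡ : ⟪ w , w ⟫ ≡ Σᶠ (λ k → ℕtoℚ (c k) * ⟪ Δ k , w ⟫)
    ⟪w,w⟫≡ = trans (⟪⟫-cong w≐⟦c⟧ ≐.refl) (⟪⟫-lincombˡ (ℕtoℚ ∘ c) Δ w)

  Φ⁺-plus-simple : ∀ {α} k → Φ⁺ α → ⟪ α , Δ k ⟫ < 0ℚ → Φ⁺ (α +ᵥ Δ k)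
  Φ⁺-plus-simple {α} k Φ⁺α@(α∈Φ , α∈ℕΔ) ⟪α,Δₖ⟫<0 =
    Sum.[ (λ α+Δₖ∈Φ → α+Δₖ∈Φ , ℕΔ-+ α∈ℕΔ (simple∈ℕΔ k))
        , (λ α+Δₖ≐0 → ⊥-elim (Φ⁺⇒¬ℕΔ- Φ⁺α (ℕΔ-resp (λ t → -α≡Δₖ t (α+Δₖ≐0 t)) (simple∈ℕΔ k)))) ]
      (⟪⟫-neg⇒sum α∈Φ (inΦ k) ⟪α,Δₖ⟫<0)
    where
    -α≡Δₖ : ∀ t → α t + Δ k t ≡ 0ℚ → Δ k t ≡ - α t
    -α≡Δₖ t α+Δ≡0 = trans (solve 2 (λ a d → d := (a :+ d) :- a) refl (α t) (Δ k t))
                          (trans (cong (_- α t) α+Δ≡0) (ℚₚ.+-identityˡ (- α t)))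

  Φ⁺-minus-simple-above : ∀ {h α θ} k → Φ⁺ α → Φ⁺ θ → 0ℚ < ⟪ θ , Δ k ⟫ → Gap h (α +ᵥ Δ k) θ →
                      Φ⁺ (θ -ᵥ Δ k) × Gap h α (θ -ᵥ Δ k)
  Φ⁺-minus-simple-above {α = α} {θ} k Φ⁺α Φ⁺θ 0<⟪θ,Δₖ⟫ g =
    Sum.[ (λ Φ⁺θ-Δₖ → Φ⁺θ-Δₖ , g′)
        , (λ θ-Δₖ≐0 → ⊥-elim (Φ⁺⇒¬ℕΔ- Φ⁺α (ℕΔ-resp (λ t → trans (cong (_- α t) (θ-Δₖ≐0 t)) (ℚₚ.+-identityˡ (- α t)))
                                                       (Gap⇒≼ g′)))) ]
      (Φ⁺-minus-simple k Φ⁺θ (⟪⟫-pos⇒difference (proj₁ Φ⁺θ) (inΦ k) 0<⟪θ,Δₖ⟫))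
    where
    g′ = Gap-shift k g

  -- Take a simple root δ = Δ k in the support of θ − α with ⟪δ, θ − α⟫ > 0.  Either ⟪θ, δ⟫ > 0 and
  -- θ − δ works, or ⟪α, δ⟫ < 0, α + δ is a positive root closer to θ, and we recurse.
  mutual
    descend : ∀ h {α θ} → Φ⁺ α → Φ⁺ θ → Gap (suc h) α θ → ∃ λ i → Φ⁺ (θ -ᵥ Δ i) × Gap h α (θ -ᵥ Δ i)
    descend h {α} {θ} Φ⁺α Φ⁺θ g@(gap c θ-α≐⟦c⟧ hc) =
      let k , 1≤cₖ , 0<⟪Δₖ,θ-α⟫ = ∃simple-direction c θ-α≐⟦c⟧ (Gap-suc⇒≉ g)
          g′ = Gap-step-down c θ-α≐⟦c⟧ hc k 1≤cₖ
      in  case 0ℚ ℚₚ.<? ⟪ θ , Δ k ⟫ of λ where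
            (yes 0<⟪θ,Δₖ⟫) → k , Φ⁺-minus-simple-above k Φ⁺α Φ⁺θ 0<⟪θ,Δₖ⟫ g′
            (no 0≮⟪θ,Δₖ⟫)  → ascend h k Φ⁺α (Φ⁺-plus-simple k Φ⁺α (⟪α,Δₖ⟫<0 k 0<⟪Δₖ,θ-α⟫ (ℚₚ.≮⇒≥ 0≮⟪θ,Δₖ⟫))) Φ⁺θ g′
      where
      ⟪α,Δₖ⟫<0 : ∀ k → 0ℚ < ⟪ Δ k , θ -ᵥ α ⟫ → ⟪ θ , Δ k ⟫ ≤ 0ℚ → ⟪ α , Δ k ⟫ < 0ℚ
      ⟪α,Δₖ⟫<0 k 0<⟪Δₖ,θ-α⟫ ⟪θ,Δₖ⟫≤0 = subst (_< 0ℚ) (sym ⟪α,Δₖ⟫≡) (ℚₚ.+-mono-≤-< ⟪θ,Δₖ⟫≤0 (ℚₚ.neg-antimono-< 0<⟪Δₖ,θ-α⟫))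
        where
        ⟪α,Δₖ⟫≡ : ⟪ α , Δ k ⟫ ≡ ⟪ θ , Δ k ⟫ + - ⟪ Δ k , θ -ᵥ α ⟫
        ⟪α,Δₖ⟫≡ = trans (solve 2 (λ a b → a := b :+ :- (b :- a)) refl ⟪ α , Δ k ⟫ ⟪ θ , Δ k ⟫)
          (cong (λ x → ⟪ θ , Δ k ⟫ + - x) (sym (trans (⟪⟫-distribʳ--ᵥ (Δ k) θ α) (cong₂ _-_ (⟪⟫-sym (Δ k) θ) (⟪⟫-sym (Δ k) α)))))

    ascend : ∀ h {α θ} k → Φ⁺ α → Φ⁺ (α +ᵥ Δ k) → Φ⁺ θ → Gap h (α +ᵥ Δ k) θ →
             ∃ λ i → Φ⁺ (θ -ᵥ Δ i) × Gap h α (θ -ᵥ Δ i)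
    ascend zero k Φ⁺α _ _ g = k , Φ⁺-resp (-ᵥ≐0⇒≐ (Gap-zero (Gap-shift k g))) Φ⁺α , Gap-shift k g
    ascend (suc h) k _ Φ⁺α+Δₖ Φ⁺θ g =
      let i , Φ⁺θ-Δᵢ , g′ = descend h Φ⁺α+Δₖ Φ⁺θ g
      in  i , Φ⁺θ-Δᵢ , Gap-step-up k g′

  BelowSummands : Vecℚ n → Vecℚ n → Vecℚ n → Set
  BelowSummands α β γ = α ≼Δ β ⊎ α ≼Δ γ ⊎
    (∃ λ β′ → ∃ λ γ′ → Φ⁺ β′ × Φ⁺ γ′ × β′ ≼Δ β × γ′ ≼Δ γ × α ≐ β′ +ᵥ γ′)

  BelowSummands-monoˡ : ∀ {α β β′ γ} → β′ ≼Δ β → BelowSummands α β′ γ → BelowSummands α β γ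
  BelowSummands-monoˡ {α} {β} {β′} β′≼β (inj₁ α≼β′) = inj₁ (≼-trans {α} {β′} {β} α≼β′ β′≼β)
  BelowSummands-monoˡ _ (inj₂ (inj₁ α≼γ)) = inj₂ (inj₁ α≼γ)
  BelowSummands-monoˡ {β = β} {β′} β′≼β (inj₂ (inj₂ (β″ , γ″ , Φ⁺β″ , Φ⁺γ″ , β″≼β′ , γ″≼γ , α≐β″+γ″))) =
    inj₂ (inj₂ (β″ , γ″ , Φ⁺β″ , Φ⁺γ″ , ≼-trans {β″} {β′} {β} β″≼β′ β′≼β , γ″≼γ , α≐β″+γ″))

  BelowSummands-monoʳ : ∀ {α β γ γ′} → γ′ ≼Δ γ → BelowSummands α β γ′ → BelowSummands α β γ
  BelowSummands-monoʳ _ (inj₁ α≼β) = inj₁ α≼β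
  BelowSummands-monoʳ {α} {γ = γ} {γ′} γ′≼γ (inj₂ (inj₁ α≼γ′)) = inj₂ (inj₁ (≼-trans {α} {γ′} {γ} α≼γ′ γ′≼γ))
  BelowSummands-monoʳ {γ = γ} {γ′} γ′≼γ (inj₂ (inj₂ (β″ , γ″ , Φ⁺β″ , Φ⁺γ″ , β″≼β , γ″≼γ′ , α≐β″+γ″))) =
    inj₂ (inj₂ (β″ , γ″ , Φ⁺β″ , Φ⁺γ″ , β″≼β , ≼-trans {γ″} {γ′} {γ} γ″≼γ′ γ′≼γ , α≐β″+γ″))

  -- β and γ may also be 0, so that removing δ from a summand equal to δ needs no separate case.
  decompose : ∀ h {α β γ} → Φ⁺ α → Φ⁺₀ β → Φ⁺₀ γ → Φ⁺ (β +ᵥ γ) → Gap h α (β +ᵥ γ) → BelowSummands α β γ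
  decompose h {α} {β} {γ} _ (inj₂ β≐0) _ _ g =
    inj₂ (inj₁ (Gap⇒≼ (Gap-congʳ (λ t → trans (cong (_+ γ t) (β≐0 t)) (ℚₚ.+-identityˡ (γ t))) g)))
  decompose h {α} {β} {γ} _ (inj₁ _) (inj₂ γ≐0) _ g =
    inj₁ (Gap⇒≼ (Gap-congʳ (λ t → trans (cong (β t +_) (γ≐0 t)) (ℚₚ.+-identityʳ (β t))) g))
  decompose zero {α} {β} {γ} _ (inj₁ Φ⁺β) (inj₁ Φ⁺γ) _ g =
    inj₂ (inj₂ (β , γ , Φ⁺β , Φ⁺γ , ≼-refl {β} , ≼-refl {γ} , -ᵥ≐0⇒≐ (Gap-zero g)))
  decompose (suc h) {α} {β} {γ} Φ⁺α (inj₁ Φ⁺β) (inj₁ Φ⁺γ) Φ⁺β+γ g =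
    let i , Φ⁺β+γ-Δᵢ , g′ = descend h Φ⁺α Φ⁺β+γ g
    in  Sum.[ (λ β-Δᵢ → BelowSummands-monoˡ {α} {β} {β -ᵥ Δ i} {γ} (minus-simple-≼ β i)
                (decompose h Φ⁺α (Φ⁺-minus-simple i Φ⁺β β-Δᵢ) (inj₁ Φ⁺γ)
                           (Φ⁺-resp (shiftˡ i) Φ⁺β+γ-Δᵢ) (Gap-congʳ (shiftˡ i) g′)))
            , (λ γ-Δᵢ → BelowSummands-monoʳ {α} {β} {γ} {γ -ᵥ Δ i} (minus-simple-≼ γ i)
                (decompose h Φ⁺α (inj₁ Φ⁺β) (Φ⁺-minus-simple i Φ⁺γ γ-Δᵢ)
                           (Φ⁺-resp (shiftʳ i) Φ⁺β+γ-Δᵢ) (Gap-congʳ (shiftʳ i) g′))) ]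
          (peel (proj₁ Φ⁺β) (proj₁ Φ⁺γ) (proj₁ Φ⁺β+γ) (inΦ i) (proj₁ Φ⁺β+γ-Δᵢ))
    where
    shiftˡ : ∀ i → (β +ᵥ γ) -ᵥ Δ i ≐ (β -ᵥ Δ i) +ᵥ γ
    shiftˡ i t = solve 3 (λ b g d → (b :+ g) :- d := (b :- d) :+ g) refl (β t) (γ t) (Δ i t)
    shiftʳ : ∀ i → (β +ᵥ γ) -ᵥ Δ i ≐ β +ᵥ (γ -ᵥ Δ i)
    shiftʳ i t = solve 3 (λ b g d → (b :+ g) :- d := b :+ (g :- d)) refl (β t) (γ t) (Δ i t)

lemma5 : ∀ {n N r : ℕ} (E : InnerProduct n) (Φ : Fin N → Vecℚ n) (Δ : Fin r → Vecℚ n) →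
           IsRootSystem E Φ → Irreducible E Φ → IsBase Φ Δ →
           ∀ (α β γ : Vecℚ n) →
           Positive Φ Δ α → Positive Φ Δ β → Positive Φ Δ γ → Positive Φ Δ (β +ᵥ γ) →
           _≼_ Φ Δ α (β +ᵥ γ) →
           _≼_ Φ Δ α β ⊎ _≼_ Φ Δ α γ ⊎
           (∃ λ (β′ : Vecℚ n) → ∃ λ (γ′ : Vecℚ n) →
              Positive Φ Δ β′ × Positive Φ Δ γ′ × _≼_ Φ Δ β′ β × _≼_ Φ Δ γ′ γ × (α ≐ (β′ +ᵥ γ′)))
lemma5 E Φ Δ RS _ B α β γ Φ⁺α Φ⁺β Φ⁺γ Φ⁺β+γ (c , β+γ-α≐⟦c⟧) =
  decompose (height c) Φ⁺α (inj₁ Φ⁺β) (inj₁ Φ⁺γ) Φ⁺β+γ (gap c β+γ-α≐⟦c⟧ refl)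
  where open BaseProperties E RS B
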